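{- Let $L$ be a model and let $f:L\to L$ be $\alpha$-monotone for every $\alpha<\kappa$. Let $X\subseteq L$ be a set of pre-fixed points of $f$ with respect to $\leq$ (i.e., $f(x)\leq x$ for all $x\in X$). Then there is a unique $y\in L$ such that $y\sqsubseteq x$ for all $x\in X$, $f(y)=y$, and for all $z\in L$, if $z\sqsubseteq x$ for all $x\in X$ and $z\sqsubseteq f(z)$, then $z\sqsubseteq y$.
   Context: Fix a limit ordinal $\kappa$. A stratified complete lattice is $(L,\leq,(\sqsubseteq_\alpha)_{\alpha<\kappa})$ with $(L,\leq)$ a complete lattice and each $\sqsubseteq_\alpha$ a preorder; $x=_\alpha y$ means $x\sqsubseteq_\alpha y$ and $y\sqsubseteq_\alpha x$. A model satisfies: (A1) for $\alpha<\beta<\kappa$, $x\sqsubseteq_\beta y$ implies $x=_\alpha y$; (A2) if $x=_\alpha y$ for all $\alpha$ then $x=y$; (A3) for all $x,\alpha$ there is $y$ with $x=_\alpha y$ such that $x\sqsubseteq_\alpha z$ implies $y\leq z$ (unique, denoted $x|_\alpha$); (A4) for nonempty $I$ and $x_i=_\alpha y$ ($i\in I$), $\bigvee_i x_i=_\alpha y$; (A5) $x\leq y$ implies $x|_\alpha\leq y|_\alpha$; (A6) if $x\leq y$ and $x=_\beta y$ for all $\beta<\alpha$ then $x\sqsubseteq_\alpha y$. On a model, $x\sqsubseteq y$ iff $x=y$ or there is $\alpha<\kappa$ with $x\sqsubseteq_\alpha y$ and not $y\sqsubseteq_\alpha x$. A function $f:L\to L$ is $\alpha$-monotone if $x\sqsubseteq_\alpha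 y$ implies $f(x)\sqsubseteq_\alpha f(y)$. -}

module Defs where

open import Level using (Level; _⊔_) renaming (suc to lsuc)
open import Data.Product using (Σ; ∃; _×_; _,_)
open import Data.Sum using (_⊎_)
open import Relation.Nullary using (¬_)
open import Relation.Binary.Core using (Rel)
open import Relation.Binary.Definitions using (Trichotomous; Transitive; Irreflexive)
open import Relation.Binary.PropositionalEquality using (_≡_)
open import Induction.WellFounded using (WellFounded)

-- A limit ordinal κ, represented by the well-ordered set of ordinals
-- below it: a strict well-order (irreflexive, transitive, trichotomous,
-- well-founded) which is nonempty (κ ≠ 0) and has no largest element
-- (κ is not a successor).
record LimitOrdinal (o ℓo : Level) : Set (lsuc (o ⊔ ℓo)) where
  field
    Ord        : Set o
    _<_        : Rel Ord ℓo
    <-irrefl   : Irreflexive _≡_ _<_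
    <-trans    : Transitive _<_
    <-tri      : Trichotomous _≡_ _<_
    <-wf       : WellFounded _<_
    nonzero    : Ord
    unbounded  : ∀ α → ∃ λ β → α < β

-- A model: a complete lattice (L, ≤) (joins of all families indexed by
-- types of level c, in particular of all subsets Pred L c) with a family
-- of preorders ⊑_α, α < κ, satisfying (A1)–(A6).
record Model {o ℓo : Level} (κ : LimitOrdinal o ℓo) (c ℓ : Level)
       : Set (lsuc (o ⊔ ℓo ⊔ c ⊔ ℓ)) where
  open LimitOrdinal κ
  field
    L      : Set c
    _≤_    : Rel L ℓ
    ≤-refl    : ∀ {x} → x ≤ x
    ≤-trans   : ∀ {x y z} → x ≤ y → y ≤ z → x ≤ z
    ≤-antisym : ∀ {x y} → x ≤ y → y ≤ x → x ≡ y
    ⋁          : (I : Set c) → (I → L) → L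
    ⋁-upper    : ∀ (I : Set c) (xs : I → L) (i : I) → xs i ≤ ⋁ I xs
    ⋁-least    : ∀ (I : Set c) (xs : I → L) (z : L) →
                 (∀ i → xs i ≤ z) → ⋁ I xs ≤ z
    _⊑[_]_    : L → Ord → L → Set ℓ
    ⊑-refl    : ∀ {α x} → x ⊑[ α ] x
    ⊑-trans   : ∀ {α x y z} → x ⊑[ α ] y → y ⊑[ α ] z → x ⊑[ α ] z

  _=[_]_ : L → Ord → L → Set ℓ
  x =[ α ] y = x ⊑[ α ] y × y ⊑[ α ] x

  IsRestriction : L → Ord → L → Set (c ⊔ ℓ)
  IsRestriction x α y = x =[ α ] y × (∀ z → x ⊑[ α ] z → y ≤ z)

  field
    A1 : ∀ {α β x y} → α < β → x ⊑[ β ] y → x =[ α ] y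
    A2 : ∀ {x y} → (∀ α → x =[ α ] y) → x ≡ y
    A3 : ∀ x α → Σ L λ y → IsRestriction x α y
    A4 : ∀ α (I : Set c) → I → (xs : I → L) (y : L) →
         (∀ i → xs i =[ α ] y) → ⋁ I xs =[ α ] y
    A5 : ∀ {x y α x' y'} → IsRestriction x α x' → IsRestriction y α y' →
         x ≤ y → x' ≤ y'
    A6 : ∀ {x y α} → x ≤ y → (∀ β → β < α → x =[ β ] y) → x ⊑[ α ] y

  _⊑_ : L → L → Set (o ⊔ c ⊔ ℓ)
  x ⊑ y = x ≡ y ⊎ Σ Ord λ α → x ⊑[ α ] y × ¬ (y ⊑[ α ] x)

  Monotone[_] : Ord → (L → L) → Set (c ⊔ ℓ)
  Monotone[ α ] f = ∀ {x y} → x ⊑[ α ] y → f x ⊑[ α ] f y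

module Submission where

-- The global order ⊑ of a model is itself complete: every
-- predicate S on L has a ⊑-least upper bound.  Call x ∈ S *dominant below*
-- γ when every member of S that agrees with x below some δ < γ is ⊑[δ] x.
-- The supremum of S is the ≤-join of all restrictions x ↾ ε of elements
-- x ∈ S dominant below ε; axioms (A3)–(A6) show that it is an upper bound
-- and least, even level by level (sup-least-at).
--
-- For the corollary take S = { z ∣ z ⊑ x for all x ∈ X, and z ⊑ f z } and
-- y = sup S.  Then y ⊑ X (y is least above S, and X bounds S), every z ∈ S
-- is ⊑ y, and f y = y follows from (A2) once y =[γ] f y holds for every γ,
-- which is proved by well-founded induction on γ: y ⊑[γ] f y by the
-- level-γ least upper bound property and monotonicity of f, and
-- f y ⊑[γ] y because (f y) ↾ γ again lies in S.  Uniqueness is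
-- antisymmetry of ⊑.  Excluded middle is used to decide statements about
-- levels and to index the join defining sup by a small type.

open import Defs
open import Level using (_⊔_; Lift; lift; lower)
open import Data.Product using (Σ; _×_; _,_; proj₁; proj₂)
open import Data.Sum using (_⊎_; inj₁; inj₂)
open import Data.Bool using (Bool; true; false)
open import Data.Empty using (⊥-elim)
open import Relation.Nullary using (¬_; yes; no)
open import Relation.Nullary.Decidable using (True; toWitness; fromWitness)
open import Relation.Unary using (Pred; _∈_)
open import Relation.Binary.PropositionalEquality using (_≡_; refl; sym; subst)
open import Relation.Binary.Definitions using (tri<; tri≈; tri>)
open import Induction.WellFounded using (Acc; acc)
open import Axiom.ExcludedMiddle using (ExcludedMiddle)

module ModelTheory {o ℓo c ℓ} (em : ExcludedMiddle (o ⊔ ℓo ⊔ c ⊔ ℓ))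
  (κ : LimitOrdinal o ℓo) (M : Model κ c ℓ) where
  open LimitOrdinal κ
  open Model M

  𝓁 : Level.Level
  𝓁 = o ⊔ ℓo ⊔ c ⊔ ℓ

  =-sym : ∀ {x y α} → x =[ α ] y → y =[ α ] x
  =-sym (p , q) = q , p

  =-trans : ∀ {x y z α} → x =[ α ] y → y =[ α ] z → x =[ α ] z
  =-trans (p , q) (p' , q') = ⊑-trans p p' , ⊑-trans q' q

  =-down : ∀ {α β x y} → α < β → x =[ β ] y → x =[ α ] y
  =-down α<β e = A1 α<β (proj₁ e)

  _=[<_]_ : L → Ord → L → Set (o ⊔ ℓo ⊔ ℓ)
  x =[< γ ] y = ∀ δ → δ < γ → x =[ δ ] y

  infixl 30 _↾_
  _↾_ : L → Ord → L
  x ↾ α = proj₁ (A3 x α)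

  ↾-agrees : ∀ x α → x =[ α ] x ↾ α
  ↾-agrees x α = proj₁ (proj₂ (A3 x α))

  ↾-least : ∀ {x α z} → x ⊑[ α ] z → x ↾ α ≤ z
  ↾-least {x} {α} {z} p = proj₂ (proj₂ (A3 x α)) z p

  ⊑-split : ∀ {x u} γ → x ⊑ u →
            (Σ Ord λ α → α < γ × x ⊑[ α ] u × ¬ (u ⊑[ α ] x)) ⊎ x ⊑[ γ ] u
  ⊑-split γ (inj₁ refl) = inj₂ ⊑-refl
  ⊑-split γ (inj₂ (α , p , np)) with <-tri α γ
  ... | tri< α<γ _ _ = inj₁ (α , α<γ , p , np)
  ... | tri≈ _ refl _ = inj₂ p
  ... | tri> _ _ γ<α = inj₂ (proj₁ (A1 γ<α p))

  ⊑-at : ∀ {x u γ} → x ⊑ u → x =[< γ ] u → x ⊑[ γ ] u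
  ⊑-at {γ = γ} x⊑u agree with ⊑-split γ x⊑u
  ... | inj₁ (α , α<γ , _ , np) = ⊥-elim (np (proj₂ (agree α α<γ)))
  ... | inj₂ p = p

  ⊑-strict-transfer : ∀ {w y x α} → w =[ α ] y → y ⊑[ α ] x → ¬ (x ⊑[ α ] y) → w ⊑ x
  ⊑-strict-transfer {α = α} w=y p np =
    inj₂ (α , ⊑-trans (proj₁ w=y) p , λ q → np (⊑-trans q (proj₁ w=y)))

  -- To prove x ⊑ z it suffices to prove x ⊑[γ] z at every level γ below
  -- which x and z agree: either some such level is the first disagreement
  -- (strict case), or by induction x and z agree everywhere and (A2) applies.
  ⊑-intro : ∀ {x z} → (∀ γ → x =[< γ ] z → x ⊑[ γ ] z) → x ⊑ z
  ⊑-intro {x} {z} h with em {Lift 𝓁 (Σ Ord λ γ → x =[< γ ] z × ¬ (x =[ γ ] z))}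
  ... | yes (lift (γ , agree , ne)) = inj₂ (γ , h γ agree , λ q → ne (h γ agree , q))
  ... | no none = inj₁ (A2 λ γ → everywhere γ (<-wf γ))
    where
    everywhere : ∀ γ → Acc _<_ γ → x =[ γ ] z
    everywhere γ (acc rs) with em {Lift 𝓁 (x =[ γ ] z)}
    ... | yes (lift e) = e
    ... | no ne = ⊥-elim (none (lift (γ , (λ δ δ<γ → everywhere δ (rs δ<γ)) , λ e → ne (lift e))))

  ≤⇒⊑ : ∀ {x z} → x ≤ z → x ⊑ z
  ≤⇒⊑ x≤z = ⊑-intro λ γ agree → A6 x≤z agree

  ⊑-antisym : ∀ {x y} → x ⊑ y → y ⊑ x → x ≡ y
  ⊑-antisym (inj₁ e) _ = e
  ⊑-antisym (inj₂ _) (inj₁ e) = sym e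
  ⊑-antisym (inj₂ (α , p , np)) (inj₂ (β , q , nq)) with <-tri α β
  ... | tri< α<β _ _ = ⊥-elim (np (proj₁ (A1 α<β q)))
  ... | tri≈ _ refl _ = ⊥-elim (np q)
  ... | tri> _ _ β<α = ⊥-elim (nq (proj₁ (A1 β<α p)))

  pair : L → L → Lift c Bool → L
  pair a b (lift true) = a
  pair a b (lift false) = b

  _∨_ : L → L → L
  a ∨ b = ⋁ (Lift c Bool) (pair a b)

  ∨-absorb : ∀ {a b} → a ≤ b → a ∨ b ≡ b
  ∨-absorb {a} {b} a≤b =
    ≤-antisym (⋁-least _ (pair a b) b λ { (lift true) → a≤b ; (lift false) → ≤-refl })
              (⋁-upper _ (pair a b) (lift false))

  ⋁-∨-member : ∀ (K : Set c) (xs : K → L) (k : K) →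
               ⋁ K (λ i → xs i ∨ xs k) ≡ ⋁ K xs
  ⋁-∨-member K xs k =
    ≤-antisym (⋁-least K _ _ λ i → ⋁-least _ (pair (xs i) (xs k)) _
                 λ { (lift true) → ⋁-upper K xs i ; (lift false) → ⋁-upper K xs k })
              (⋁-least K xs _ λ i → ≤-trans (⋁-upper _ (pair (xs i) (xs k)) (lift true))
                                            (⋁-upper K (λ j → xs j ∨ xs k) i))

  ⋁-agrees : ∀ {γ v} (K : Set c) (xs : K → L) (k : K) → xs k =[ γ ] v →
             (∀ i → xs i =[ γ ] v ⊎ xs i ≤ xs k) → ⋁ K xs =[ γ ] v
  ⋁-agrees {γ} {v} K xs k xk=v h =
    subst (λ w → w =[ γ ] v) (⋁-∨-member K xs k) (A4 γ K k (λ i → xs i ∨ xs k) v joined-agrees)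
    where
    joined-agrees : ∀ i → (xs i ∨ xs k) =[ γ ] v
    joined-agrees i with h i
    ... | inj₁ xi=v = A4 γ (Lift c Bool) (lift true) (pair (xs i) (xs k)) v
                        λ { (lift true) → xi=v ; (lift false) → xk=v }
    ... | inj₂ xi≤xk = subst (λ w → w =[ γ ] v) (sym (∨-absorb xi≤xk)) xk=v

  module LeastUpperBound (S : L → Set 𝓁) where
    Dominant : Ord → L → Set 𝓁
    Dominant γ x = ∀ x' → S x' → ∀ δ → δ < γ → x' =[< δ ] x → x' ⊑[ δ ] x

    Dominant-down : ∀ {γ ε x} → γ < ε → Dominant ε x → Dominant γ x
    Dominant-down γ<ε dom x' sx' δ δ<γ = dom x' sx' δ (<-trans δ<γ γ<ε)

    Candidate : L → Set 𝓁
    Candidate q = Σ L λ x → Σ Ord λ ε → S x × Dominant ε x × q ≡ x ↾ ε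

    -- Candidates as a family indexed by a type of level c (via excluded middle).
    Index : Set c
    Index = Σ L λ q → Lift c (True (em {Candidate q}))

    sup : L
    sup = ⋁ Index proj₁

    candidate-of : (i : Index) → Candidate (proj₁ i)
    candidate-of (q , lift t) = toWitness t

    candidate-index : ∀ {q} → Candidate q → Index
    candidate-index {q} cand = q , lift (fromWitness cand)

    candidate≤sup : ∀ {q} → Candidate q → q ≤ sup
    candidate≤sup cand = ⋁-upper Index proj₁ (candidate-index cand)

    sup≤ : ∀ {z} → (∀ q → Candidate q → q ≤ z) → sup ≤ z
    sup≤ h = ⋁-least Index proj₁ _ λ i → h (proj₁ i) (candidate-of i)

    dominant-agree : ∀ {γ x x'} → S x → Dominant γ x → S x' → Dominant γ x' → x =[< γ ] x'
    dominant-agree {γ} {x} {x'} sx dx sx' dx' δ δ<γ = go δ (<-wf δ) δ<γ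
      where
      go : ∀ δ → Acc _<_ δ → δ < γ → x =[ δ ] x'
      go δ (acc rs) δ<γ =
          dx' x sx δ δ<γ (λ ε ε<δ → go ε (rs ε<δ) (<-trans ε<δ δ<γ))
        , dx x' sx' δ δ<γ (λ ε ε<δ → =-sym (go ε (rs ε<δ) (<-trans ε<δ δ<γ)))

    candidate-≤ : ∀ {x ε x' η} → S x → Dominant ε x → S x' → Dominant η x' → ε < η →
                  x ↾ ε ≤ x' ↾ η
    candidate-≤ {x} {ε} {x'} {η} sx dx sx' dx' ε<η =
      ↾-least (⊑-trans (dx' x sx ε ε<η (dominant-agree sx dx sx' (Dominant-down ε<η dx')))
                       (proj₁ (=-down ε<η (↾-agrees x' η))))

    sup-agrees : ∀ {x' η} → S x' → Dominant η x' → sup =[< η ] x'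
    sup-agrees {x'} {η} sx' dx' δ δ<η =
      ⋁-agrees Index proj₁ (candidate-index (x' , η , sx' , dx' , refl))
               (=-sym (=-down δ<η (↾-agrees x' η))) compare
      where
      compare : ∀ i → proj₁ i =[ δ ] x' ⊎ proj₁ i ≤ x' ↾ η
      compare i with candidate-of i
      ... | x , ε , sx , dx , refl with <-tri ε η
      ...   | tri< ε<η _ _ = inj₂ (candidate-≤ sx dx sx' dx' ε<η)
      ...   | tri≈ _ refl _ =
              inj₁ (=-trans (=-sym (=-down δ<η (↾-agrees x ε))) (dominant-agree sx dx sx' dx' δ δ<η))
      ...   | tri> _ _ η<ε =
              inj₁ (=-trans (=-sym (=-down (<-trans δ<η η<ε) (↾-agrees x ε)))
                            (dominant-agree sx (Dominant-down η<ε dx) sx' dx' δ δ<η))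

    -- Level-wise upper bound: a member agreeing with sup below δ is
    -- dominant below δ (by induction), so x ↾ δ is a candidate.
    sup-upper-at : ∀ δ → Acc _<_ δ → ∀ x → S x → x =[< δ ] sup → x ⊑[ δ ] sup
    sup-upper-at δ (acc rs) x sx x=sup =
      ⊑-trans (proj₁ (↾-agrees x δ))
              (A6 (candidate≤sup (x , δ , sx , dominant , refl))
                  λ ζ ζ<δ → =-trans (=-sym (=-down ζ<δ (↾-agrees x δ))) (x=sup ζ ζ<δ))
      where
      dominant : Dominant δ x
      dominant x' sx' ε ε<δ x'=x =
        ⊑-trans (sup-upper-at ε (rs ε<δ) x' sx'
                   λ ζ ζ<ε → =-trans (x'=x ζ ζ<ε) (x=sup ζ (<-trans ζ<ε ε<δ)))
                (proj₂ (x=sup ε ε<δ))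

    sup-upper : ∀ {x} → S x → x ⊑ sup
    sup-upper sx = ⊑-intro λ γ agree → sup-upper-at γ (<-wf γ) _ sx agree

    -- Either a
    -- member dominant beyond γ pins sup down at γ, or all candidates are
    -- cut at levels ≤ γ and lie below v ↾ γ.
    sup-least-at : ∀ γ v → sup =[< γ ] v → (∀ z → S z → z =[< γ ] sup → z ⊑[ γ ] v) →
                   sup ⊑[ γ ] v
    sup-least-at γ v sup=v h
      with em {Lift 𝓁 (Σ L λ z → Σ Ord λ ε → S z × Dominant ε z × γ < ε)}
    ... | yes (lift (z , ε , sz , dz , γ<ε)) =
          ⊑-trans (proj₁ (sup-agrees sz dz γ γ<ε))
                  (h z sz λ δ δ<γ → =-sym (sup-agrees sz dz δ (<-trans δ<γ γ<ε)))
    ... | no none =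
          ⊑-trans (A6 (sup≤ below-v↾γ) λ δ δ<γ → =-trans (sup=v δ δ<γ) (=-down δ<γ (↾-agrees v γ)))
                  (proj₂ (↾-agrees v γ))
      where
      below-v↾γ : ∀ q → Candidate q → q ≤ v ↾ γ
      below-v↾γ q (x , ε , sx , dx , refl) with <-tri ε γ
      ... | tri< ε<γ _ _ =
            ↾-least (⊑-trans (⊑-at (sup-upper sx) λ ζ ζ<ε → =-sym (sup-agrees sx dx ζ ζ<ε))
                             (⊑-trans (proj₁ (sup=v ε ε<γ)) (proj₁ (=-down ε<γ (↾-agrees v γ)))))
      ... | tri≈ _ refl _ =
            ↾-least (⊑-trans (h x sx λ ζ ζ<ε → =-sym (sup-agrees sx dx ζ ζ<ε)) (proj₁ (↾-agrees v γ)))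
      ... | tri> _ _ γ<ε = ⊥-elim (none (lift (x , ε , sx , dx , γ<ε)))

    sup-least : ∀ {u} → (∀ z → S z → z ⊑ u) → sup ⊑ u
    sup-least h = ⊑-intro λ γ sup=u →
      sup-least-at γ _ sup=u λ z sz z=sup →
        ⊑-at (h z sz) λ δ δ<γ → =-trans (z=sup δ δ<γ) (sup=u δ δ<γ)

  module GreatestFixedPoint (f : L → L) (mono : ∀ α → Monotone[ α ] f)
                            (X : Pred L c) (pre : ∀ x → x ∈ X → f x ≤ x) where
    Admissible : L → Set (o ⊔ c ⊔ ℓ)
    Admissible z = (∀ x → x ∈ X → z ⊑ x) × z ⊑ f z

    open LeastUpperBound (λ z → Lift 𝓁 (Admissible z))

    y : L
    y = sup

    f-agrees : ∀ {α x z} → x =[ α ] z → f x =[ α ] f z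
    f-agrees {α} (p , q) = mono α p , mono α q

    y-below-X : ∀ x → x ∈ X → y ⊑ x
    y-below-X x x∈X = sup-least λ z adm → proj₁ (lower adm) x x∈X

    y-greatest : ∀ z → (∀ x → x ∈ X → z ⊑ x) → z ⊑ f z → z ⊑ y
    y-greatest z zX z⊑fz = sup-upper (lift (zX , z⊑fz))

    module Step (γ : Ord) (y=fy : y =[< γ ] f y) where
      y⊑fy : y ⊑[ γ ] f y
      y⊑fy = sup-least-at γ (f y) y=fy λ z adm z=y →
        let (_ , z⊑fz) = lower adm
        in ⊑-trans (⊑-at z⊑fz λ δ δ<γ →
                       =-trans (z=y δ δ<γ) (=-trans (y=fy δ δ<γ) (=-sym (f-agrees (z=y δ δ<γ)))))
                   (mono γ (⊑-at (sup-upper adm) z=y))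

      w : L
      w = f y ↾ γ

      w=y : w =[< γ ] y
      w=y δ δ<γ = =-trans (=-sym (=-down δ<γ (↾-agrees (f y) γ))) (=-sym (y=fy δ δ<γ))

      w⊑fw : w ⊑ f w
      w⊑fw = ≤⇒⊑ (↾-least (⊑-trans (mono γ y⊑fy) (mono γ (proj₁ (↾-agrees (f y) γ)))))

      -- If y ⊑[γ] x for some x ∈ X then f x and x agree below γ, so
      -- f y ⊑[γ] f x ⊑[γ] x by (A6), whence w ≤ x.
      w-below-level : ∀ {x} → x ∈ X → y ⊑[ γ ] x → w ⊑ x
      w-below-level {x} x∈X y⊑x = ≤⇒⊑ (↾-least (⊑-trans (mono γ y⊑x) (A6 (pre x x∈X) fx=x)))
        where
        fx=x : f x =[< γ ] x
        fx=x δ δ<γ = =-trans (=-sym (f-agrees (A1 δ<γ y⊑x)))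
                             (=-trans (=-sym (y=fy δ δ<γ)) (A1 δ<γ y⊑x))

      w-below-X : ∀ x → x ∈ X → w ⊑ x
      w-below-X x x∈X with ⊑-split γ (y-below-X x x∈X)
      ... | inj₁ (α , α<γ , p , np) = ⊑-strict-transfer (w=y α α<γ) p np
      ... | inj₂ p = w-below-level x∈X p

      fy⊑y : f y ⊑[ γ ] y
      fy⊑y = ⊑-trans (proj₁ (↾-agrees (f y) γ)) (⊑-at (y-greatest w w-below-X w⊑fw) w=y)

    y=fy : ∀ γ → Acc _<_ γ → y =[ γ ] f y
    y=fy γ (acc rs) = Step.y⊑fy γ below , Step.fy⊑y γ below
      where
      below : y =[< γ ] f y
      below δ δ<γ = y=fy δ (rs δ<γ)

    y-fixed : f y ≡ y
    y-fixed = sym (A2 λ γ → y=fy γ (<-wf γ))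

    y-unique : ∀ y' → ((∀ x → x ∈ X → y' ⊑ x) × f y' ≡ y' ×
                       (∀ z → (∀ x → x ∈ X → z ⊑ x) → z ⊑ f z → z ⊑ y')) → y' ≡ y
    y-unique y' (y'X , fy'≡y' , y'-greatest) =
      ⊑-antisym (y-greatest y' y'X (inj₁ (sym fy'≡y'))) (y'-greatest y y-below-X (inj₁ (sym y-fixed)))

corollary18 : ∀ {o ℓo c ℓ} → ExcludedMiddle (o ⊔ ℓo ⊔ c ⊔ ℓ) →
  (κ : LimitOrdinal o ℓo) (M : Model κ c ℓ) →
  let open LimitOrdinal κ
      open Model M
  in (f : L → L) → (∀ α → Monotone[ α ] f) →
     (X : Pred L c) → (∀ x → x ∈ X → f x ≤ x) →
     Σ L λ y →
       ((∀ x → x ∈ X → y ⊑ x) × f y ≡ y ×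
        (∀ z → (∀ x → x ∈ X → z ⊑ x) → z ⊑ f z → z ⊑ y))
       × (∀ y' → ((∀ x → x ∈ X → y' ⊑ x) × f y' ≡ y' ×
                  (∀ z → (∀ x → x ∈ X → z ⊑ x) → z ⊑ f z → z ⊑ y'))
               → y' ≡ y)
corollary18 em κ M f mono X pre = y , (y-below-X , y-fixed , y-greatest) , y-unique
  where
  open ModelTheory em κ M
  open GreatestFixedPoint f mono X pre
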